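{- Let $m,n\ge 2$ be integers with $m\ne n$, and let $G$ be a connected graph that is contractible to $K_{m,n}$ via a partition of $V(G)$ into bags in which at most one bag $Z$ has $|Z|\ge 2$. If such a bag $Z$ (when it exists) induces a connected subgraph of $G$, then $G\notin\mathcal{G}^{\mathrm{cs}}$.
   Context: All graphs are finite and simple. A graph $G$ is contractible to a graph $H$ if there is a surjection $\phi:V(G)\to V(H)$ such that for all distinct $h_i,h_j\in V(H)$, some edge of $G$ joins $\phi^{ -1}(h_i)$ and $\phi^{ -1}(h_j)$ iff $h_ih_j\in E(H)$; the sets $\phi^{ -1}(h)$ are the bags. A weight function on $V(G)$ is a map $w:V(G)\to\mathbb{R}_{>0}$; for $X\subseteq V(G)$ put $w(X)=\sum_{v\in X}w(v)$. A non-empty set $S\subseteq V(G)$ is a weighted safe set of $(G,w)$ if for every component $C$ of the induced subgraph $G[S]$ and every component $D$ of $G-S$ such that some edge joins $C$ and $D$, we have $w(C)\ge w(D)$. It is a connected weighted safe set if moreover $G[S]$ is connected. $\mathrm{s}(G,w)$ (resp. $\mathrm{cs}(G,w)$) is the minimum of $w(S)$ over all weighted safe sets (resp. connected weighted safe sets) $S$ of $(G,w)$. $\mathcal{G}^{\mathrm{cs}}$ denotes the family of all graphs $G$ such that $\mathrm{s}(G,w)=\mathrm{cs}(G,w)$ for every weight function $w$ on $V(G)$. -}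

module Defs where

open import Data.Nat as ℕ using (ℕ)
open import Data.Fin as Fin using (Fin; splitAt)
open import Data.Fin.Subset using (Subset; _∈_; _∉_; ∁; ⊤; _⊆_; Nonempty)
open import Data.Bool using (Bool; true; false; if_then_else_; _xor_)
open import Data.Vec using (Vec; tabulate; lookup)
open import Data.Sum using (_⊎_; inj₁; inj₂)
open import Data.Product using (Σ; ∃; _×_; _,_)
open import Data.Rational using (ℚ; 0ℚ; _+_; _≤_; _<_)
open import Relation.Nullary using (¬_; does)
open import Relation.Binary.PropositionalEquality using (_≡_; _≢_)
open import Function.Bundles using (_⇔_)

record Graph : Set where
  field
    order : ℕ
    adj   : Fin order → Fin order → Bool
    sym   : ∀ u v → adj u v ≡ adj v u
    irr   : ∀ u → adj u u ≡ false

module _ (G : Graph) where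
  open Graph G

  Adj : Fin order → Fin order → Set
  Adj u v = adj u v ≡ true

  -- walks in G all of whose vertices lie in C (i.e. walks in G[C])
  data Walk (C : Subset order) : Fin order → Fin order → Set where
    here : ∀ {u} → u ∈ C → Walk C u u
    step : ∀ {u v x} → u ∈ C → Adj u v → Walk C v x → Walk C u x

  Connected : Subset order → Set
  Connected C = ∀ u v → u ∈ C → v ∈ C → Walk C u v

  ConnectedGraph : Set
  ConnectedGraph = Connected ⊤

  -- C is (the vertex set of) a component of G[S]: a non-empty connected
  -- subset of S with no edge to the rest of S (i.e. a maximal connected subset).
  IsComponent : Subset order → Subset order → Set
  IsComponent S C =
    C ⊆ S × Nonempty C × Connected C ×
    (∀ u v → u ∈ C → v ∈ S → v ∉ C → ¬ Adj u v)

  Joined : Subset order → Subset order → Set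
  Joined X Y = ∃ λ u → ∃ λ v → u ∈ X × v ∈ Y × Adj u v

  PositiveWeight : (Fin order → ℚ) → Set
  PositiveWeight w = ∀ v → 0ℚ < w v

  wsum : ∀ {k} → (Fin k → ℚ) → Subset k → ℚ
  wsum {ℕ.zero} w X = 0ℚ
  wsum {ℕ.suc k} w X =
    (if lookup X Fin.zero then w Fin.zero else 0ℚ)
    + wsum (λ i → w (Fin.suc i)) (tabulate (λ i → lookup X (Fin.suc i)))

  IsSafe : (Fin order → ℚ) → Subset order → Set
  IsSafe w S = Nonempty S ×
    (∀ C D → IsComponent S C → IsComponent (∁ S) D → Joined C D →
      wsum w D ≤ wsum w C)

  IsConnSafe : (Fin order → ℚ) → Subset order → Set
  IsConnSafe w S = IsSafe w S × Connected S

  IsMinOver : (Fin order → ℚ) → (Subset order → Set) → ℚ → Set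
  IsMinOver w P x = (∃ λ S → P S × wsum w S ≡ x) × (∀ S → P S → x ≤ wsum w S)

  -- s(G,w) = cs(G,w) for every (positive rational) weight function w
  InGcs : Set
  InGcs = ∀ w → PositiveWeight w → ∀ x y →
    IsMinOver w (IsSafe w) x → IsMinOver w (IsConnSafe w) y → x ≡ y

-- complete bipartite graph K_{m,n} on Fin (m + n); first m vertices form one side
Kbip : ℕ → ℕ → Graph
Kbip m n = record { order = m ℕ.+ n ; adj = a ; sym = s ; irr = i }
  where
  side : Fin (m ℕ.+ n) → Bool
  side v with splitAt m v
  ... | inj₁ _ = true
  ... | inj₂ _ = false
  a : Fin (m ℕ.+ n) → Fin (m ℕ.+ n) → Bool
  a u v = side u xor side v
  s : ∀ u v → a u v ≡ a v u
  s u v with side u | side v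
  ... | true | true = _≡_.refl
  ... | true | false = _≡_.refl
  ... | false | true = _≡_.refl
  ... | false | false = _≡_.refl
  i : ∀ u → a u u ≡ false
  i u with side u
  ... | true = _≡_.refl
  ... | false = _≡_.refl

module _ (G H : Graph) where
  private
    module G = Graph G
    module H = Graph H

  bag : (Fin G.order → Fin H.order) → Fin H.order → Subset G.order
  bag φ h = tabulate (λ v → does (φ v Fin.≟ h))

  IsContraction : (Fin G.order → Fin H.order) → Set
  IsContraction φ =
    (∀ h → ∃ λ v → φ v ≡ h) ×
    (∀ h h' → h ≢ h' → (Joined G (bag φ h) (bag φ h') ⇔ Adj H h h'))

  BigBag : (Fin G.order → Fin H.order) → Fin H.order → Set
  BigBag φ h = ∃ λ u → ∃ λ v → u ≢ v × φ u ≡ h × φ v ≡ h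

module Submission where

-- Let p < q be the sizes of the two sides of K_{m,n} and c the size of the bag Z (c = 1 if every bag
-- is a single vertex). Give the vertices of Z weight 1 and all other vertices weight c, so that every
-- bag weighs c. The union of the bags of the small side is then a safe set of weight p c: each of its
-- components contains a whole bag, while each component of its complement lies in a single bag of the
-- large side. A connected safe set S of weight at most p c, however, meets at most p bags, since only Z
-- can be met partially. It cannot meet all small bags (being connected it would then meet a large bag
-- as well, or lie inside one bag), nor all large bags; and if it misses a bag on each side, then all
-- missed bags, at least q of them, lie in a single component of G - S, which outweighs S.

open import Defs
open import Algebra.Properties.Semiring.Sum as Sum using ()
open import Data.Bool.Base using (Bool; true; false; not; T; if_then_else_)
open import Data.Bool.Properties
  using (T-≡; T-not-≡; ¬-not; not-¬; not-injective; not-involutive) renaming (_≟_ to _≟ᵇ_)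
open import Data.Empty using (⊥; ⊥-elim)
open import Data.Fin.Base using (Fin; zero; suc; splitAt)
open import Data.Fin.Properties using (_≟_; any?)
open import Data.Fin.Subset using (Subset; _∈_; _∉_; _⊆_; ∁; ⊤; Nonempty; inside; outside)
open import Data.Fin.Subset.Properties using (_∈?_; ∈⊤; x∈∁p⇒x∉p; x∉p⇒x∈∁p)
open import Data.Nat.Base as ℕ using (ℕ; _+_; _*_; _∸_; _≤_; _<_; z≤n; s≤s)
import Data.Nat.Properties as ℕ
open import Data.Product using (∃; _×_; _,_; proj₁; proj₂)
open import Data.Rational.Base as ℚ using (ℚ; 0ℚ; 1ℚ)
import Data.Rational.Properties as ℚ
open import Data.Sum.Base using (_⊎_; inj₁; inj₂)
open import Data.Vec.Base using ([]; _∷_; lookup; tabulate; here; there)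
open import Data.Vec.Properties using (lookup∘tabulate; []=⇒lookup; lookup⇒[]=)
open import Function.Base using (_∘_; id; case_of_)
open import Function.Bundles using (_⇔_; mk⇔; Equivalence)
open import Function.Construct.Composition using (_⇔-∘_)
open import Relation.Binary.Definitions using (tri<; tri≈; tri>)
open import Relation.Binary.PropositionalEquality
open import Relation.Nullary using (¬_; Dec; yes; no; does)
open import Relation.Nullary.Decidable
  using (_×-dec_; ¬?; T?; decidable-stable; ¬¬-excluded-middle; dec-true; dec-false)

open Sum ℕ.+-*-semiring
  using (sum; sum-syntax; sum-cong-≗; sum-replicate-zero; ∑-distrib-+; ∑-comm; *-distribʳ-sum)

infix 8 _when_
_when_ : ℕ → Bool → ℕ
x when b = if b then x else 0

count : ∀ {k} → (Fin k → Bool) → ℕ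
count {k} f = ∑[ i < k ] (1 when f i)

∑-mono-≤ : ∀ {k} {f g : Fin k → ℕ} → (∀ i → f i ≤ g i) → sum f ≤ sum g
∑-mono-≤ {ℕ.zero} f≤g = z≤n
∑-mono-≤ {ℕ.suc k} f≤g = ℕ.+-mono-≤ (f≤g zero) (∑-mono-≤ (f≤g ∘ suc))

≤-∑ : ∀ {k} (f : Fin k → ℕ) i → f i ≤ sum f
≤-∑ f zero = ℕ.m≤m+n _ _
≤-∑ f (suc i) = ℕ.≤-trans (≤-∑ (f ∘ suc) i) (ℕ.m≤n+m _ (f zero))

∑-positive : ∀ {k} (f : Fin k → ℕ) → 0 < sum f → ∃ λ i → 0 < f i
∑-positive {ℕ.suc k} f 0<∑ with f zero in eq
... | ℕ.suc _ = zero , subst (0 <_) (sym eq) (s≤s z≤n)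
... | ℕ.zero with ∑-positive (f ∘ suc) 0<∑
...   | i , 0<fi = suc i , 0<fi

∑-point : ∀ {k} (a : Fin k) x → ∑[ j < k ] (x when does (a ≟ j)) ≡ x
∑-point {ℕ.suc k} zero x = trans (cong (x +_) (sum-replicate-zero k)) (ℕ.+-identityʳ x)
∑-point (suc a) x = ∑-point a x

∑-when : ∀ {k} (f : Fin k → Bool) x → ∑[ i < k ] (x when f i) ≡ count f * x
∑-when {k} f x = begin
  ∑[ i < k ] (x when f i)        ≡⟨ sum-cong-≗ (λ i → one-when (f i)) ⟩
  ∑[ i < k ] ((1 when f i) * x)  ≡⟨ *-distribʳ-sum x (λ i → 1 when f i) ⟨
  count f * x                    ∎
  where
  open ≡-Reasoning
  one-when : ∀ b → x when b ≡ (1 when b) * x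
  one-when true = sym (ℕ.*-identityˡ x)
  one-when false = refl

count-complement : ∀ {k} (f : Fin k → Bool) → count f + count (not ∘ f) ≡ k
count-complement {k} f = begin
  count f + count (not ∘ f)                 ≡⟨ ∑-distrib-+ (λ i → 1 when f i) (λ i → 1 when not (f i)) ⟨
  ∑[ i < k ] (1 when f i + 1 when not (f i)) ≡⟨ sum-cong-≗ (λ i → one (f i)) ⟩
  ∑[ i < k ] 1                              ≡⟨ ∑-one k ⟩
  k                                         ∎
  where
  open ≡-Reasoning
  one : ∀ b → 1 when b + 1 when not b ≡ 1
  one true = refl
  one false = refl
  ∑-one : ∀ k → ∑[ i < k ] 1 ≡ k
  ∑-one ℕ.zero = refl
  ∑-one (ℕ.suc k) = cong ℕ.suc (∑-one k)

count-mono : ∀ {k} {f g : Fin k → Bool} → (∀ i → T (f i) → T (g i)) → count f ≤ count g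
count-mono {f = f} {g} f⇒g = ∑-mono-≤ λ i → pointwise (f i) (g i) (f⇒g i)
  where
  pointwise : ∀ a b → (T a → T b) → 1 when a ≤ 1 when b
  pointwise false b _ = z≤n
  pointwise true true _ = ℕ.≤-refl
  pointwise true false a⇒b = ⊥-elim (a⇒b _)

count-insert : ∀ {k} {f g : Fin k → Bool} a → (∀ i → T (f i) → T (g i)) → ¬ T (f a) → T (g a) →
  ℕ.suc (count f) ≤ count g
count-insert {k} {f} {g} a f⇒g ¬fa ga = begin
  ℕ.suc (count f)                                    ≡⟨ ℕ.+-comm 1 (count f) ⟩
  count f + 1                                        ≡⟨ cong (count f +_) (∑-point a 1) ⟨
  count f + ∑[ i < k ] (1 when does (a ≟ i))         ≡⟨ ∑-distrib-+ (λ i → 1 when f i) _ ⟨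
  ∑[ i < k ] (1 when f i + 1 when does (a ≟ i))      ≤⟨ ∑-mono-≤ pointwise ⟩
  count g                                            ∎
  where
  open ℕ.≤-Reasoning
  pointwise : ∀ i → 1 when f i + 1 when does (a ≟ i) ≤ 1 when g i
  pointwise i with a ≟ i | f i in fi | g i in gi | f⇒g i
  ... | yes refl | true  | _     | _   = ⊥-elim (¬fa (Equivalence.from T-≡ fi))
  ... | yes refl | false | true  | _   = ℕ.≤-refl
  ... | yes refl | false | false | _   = ⊥-elim (subst T gi ga)
  ... | no _     | false | _     | _   = z≤n
  ... | no _     | true  | true  | _   = ℕ.≤-refl
  ... | no _     | true  | false | fi⇒gi = ⊥-elim (fi⇒gi _)

count-≤1 : ∀ {k} {f : Fin k → Bool} a → (∀ i → T (f i) → i ≡ a) → count f ≤ 1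
count-≤1 {k} {f} a f⇒a = ℕ.≤-trans (∑-mono-≤ pointwise) (ℕ.≤-reflexive (∑-point a 1))
  where
  pointwise : ∀ i → 1 when f i ≤ 1 when does (a ≟ i)
  pointwise i with f i in fi
  ... | false = z≤n
  ... | true rewrite f⇒a i (Equivalence.from T-≡ fi) with a ≟ a
  ...   | yes _ = ℕ.≤-refl
  ...   | no a≢a = ⊥-elim (a≢a refl)

count-positive : ∀ {k} (f : Fin k → Bool) → 0 < count f → ∃ λ i → T (f i)
count-positive f 0<count with ∑-positive (λ i → 1 when f i) 0<count
... | i , 0<fi with f i in fi | 0<fi
...   | true | _ = i , Equivalence.from T-≡ fi

toℚ : ℕ → ℚ
toℚ ℕ.zero = 0ℚ
toℚ (ℕ.suc n) = 1ℚ ℚ.+ toℚ n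

toℚ-+ : ∀ a b → toℚ (a + b) ≡ toℚ a ℚ.+ toℚ b
toℚ-+ ℕ.zero b = sym (ℚ.+-identityˡ (toℚ b))
toℚ-+ (ℕ.suc a) b = trans (cong (1ℚ ℚ.+_) (toℚ-+ a b)) (sym (ℚ.+-assoc 1ℚ (toℚ a) (toℚ b)))

toℚ-mono-≤ : ∀ {a b} → a ≤ b → toℚ a ℚ.≤ toℚ b
toℚ-mono-≤ {b = b} z≤n = nonnegative b
  where
  nonnegative : ∀ b → 0ℚ ℚ.≤ toℚ b
  nonnegative ℕ.zero = ℚ.≤-refl
  nonnegative (ℕ.suc b) = ℚ.+-mono-≤ (ℚ.<⇒≤ (ℚ.positive⁻¹ 1ℚ)) (nonnegative b)
toℚ-mono-≤ (s≤s a≤b) = ℚ.+-monoʳ-≤ 1ℚ (toℚ-mono-≤ a≤b)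

toℚ-mono-< : ∀ {a b} → a < b → toℚ a ℚ.< toℚ b
toℚ-mono-< {a} a<b = ℚ.<-≤-trans a<1+a (toℚ-mono-≤ a<b)
  where
  a<1+a : toℚ a ℚ.< toℚ (ℕ.suc a)
  a<1+a = subst (ℚ._< toℚ (ℕ.suc a)) (ℚ.+-identityˡ (toℚ a))
            (ℚ.+-mono-<-≤ (ℚ.positive⁻¹ 1ℚ) (ℚ.≤-refl {toℚ a}))

toℚ-cancel-≤ : ∀ {a b} → toℚ a ℚ.≤ toℚ b → a ≤ b
toℚ-cancel-≤ a≤b = ℕ.≮⇒≥ λ b<a → ℚ.<-irrefl refl (ℚ.≤-<-trans a≤b (toℚ-mono-< b<a))

lookup≡does-∈? : ∀ {k} (X : Subset k) i → lookup X i ≡ does (i ∈? X)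
lookup≡does-∈? (inside ∷ X) zero = refl
lookup≡does-∈? (outside ∷ X) zero = refl
lookup≡does-∈? (_ ∷ X) (suc i) = lookup≡does-∈? X i

∈-tabulate⇔ : ∀ {k} {f : Fin k → Bool} {i} → i ∈ tabulate f ⇔ f i ≡ true
∈-tabulate⇔ {f = f} {i} = mk⇔ (λ i∈ → trans (sym (lookup∘tabulate f i)) ([]=⇒lookup i∈))
                              (λ fi → lookup⇒[]= i _ (trans (lookup∘tabulate f i) fi))

fibre : ∀ {k B} → (Fin k → Fin B) → Fin B → Subset k
fibre φ h = tabulate (λ v → does (φ v ≟ h))

module _ {k B} (φ : Fin k → Fin B) {h : Fin B} {v : Fin k} where

  ∈-fibre⁻ : v ∈ fibre φ h → φ v ≡ h
  ∈-fibre⁻ v∈ with φ v ≟ h | Equivalence.to ∈-tabulate⇔ v∈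
  ... | yes φv≡h | _ = φv≡h

  ∈-fibre⁺ : φ v ≡ h → v ∈ fibre φ h
  ∈-fibre⁺ φv≡h = Equivalence.from ∈-tabulate⇔ (dec-true (φ v ≟ h) φv≡h)

  does-∈?-fibre : does (v ∈? fibre φ h) ≡ does (φ v ≟ h)
  does-∈?-fibre = trans (sym (lookup≡does-∈? (fibre φ h) v)) (lookup∘tabulate _ v)

wsum-toℚ : ∀ (G : Graph) {k} (W : Fin k → ℕ) X →
  wsum G (toℚ ∘ W) X ≡ toℚ (∑[ v < k ] (W v when does (v ∈? X)))
wsum-toℚ G {ℕ.zero} W [] = refl
wsum-toℚ G {ℕ.suc k} W (b ∷ X) = begin
  (if b then toℚ (W zero) else 0ℚ) ℚ.+ wsum G (toℚ ∘ W ∘ suc) (tabulate (lookup X))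
    ≡⟨ cong₂ ℚ._+_ (head b) (trans (wsum-toℚ G (W ∘ suc) _) (cong toℚ (sum-cong-≗ tail))) ⟩
  toℚ (W zero when does (zero ∈? (b ∷ X))) ℚ.+ toℚ (∑[ v < k ] (W (suc v) when does (v ∈? X)))
    ≡⟨ toℚ-+ (W zero when does (zero ∈? (b ∷ X))) _ ⟨
  toℚ (∑[ v < ℕ.suc k ] (W v when does (v ∈? (b ∷ X))))
    ∎
  where
  open ≡-Reasoning
  head : ∀ b → (if b then toℚ (W zero) else 0ℚ) ≡ toℚ (W zero when does (zero ∈? (b ∷ X)))
  head true = refl
  head false = refl
  tail : ∀ v → W (suc v) when does (v ∈? tabulate (lookup X)) ≡ W (suc v) when does (v ∈? X)
  tail v = cong (W (suc v) when_) (begin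
    does (v ∈? tabulate (lookup X))   ≡⟨ lookup≡does-∈? _ v ⟨
    lookup (tabulate (lookup X)) v    ≡⟨ lookup∘tabulate (lookup X) v ⟩
    lookup X v                        ≡⟨ lookup≡does-∈? X v ⟩
    does (v ∈? X)                     ∎)

-- Classical finite choices are made under ¬¬, which suffices because the theorem is a negation.
¬¬-comprehension : ∀ {k} (P : Fin k → Set) → ¬ ¬ (∃ λ (X : Subset k) → ∀ i → i ∈ X ⇔ P i)
¬¬-comprehension {ℕ.zero} P ¬X = ¬X ([] , λ ())
¬¬-comprehension {ℕ.suc k} P ¬X =
  ¬¬-excluded-middle λ P₀? → ¬¬-comprehension (P ∘ suc) λ (X , X⇔P) → ¬X (extend P₀? X X⇔P)
  where
  extend : Dec (P zero) → ∀ X → (∀ i → i ∈ X ⇔ P (suc i)) → ∃ λ X → ∀ i → i ∈ X ⇔ P i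
  extend (yes P₀) X X⇔P = inside ∷ X , λ where
    zero → mk⇔ (λ _ → P₀) (λ _ → here)
    (suc i) → mk⇔ (λ { (there i∈X) → Equivalence.to (X⇔P i) i∈X }) (there ∘ Equivalence.from (X⇔P i))
  extend (no ¬P₀) X X⇔P = outside ∷ X , λ where
    zero → mk⇔ (λ ()) (λ P₀ → ⊥-elim (¬P₀ P₀))
    (suc i) → mk⇔ (λ { (there i∈X) → Equivalence.to (X⇔P i) i∈X }) (there ∘ Equivalence.from (X⇔P i))

Minimiser : ∀ {k} → (Subset k → Set) → (Subset k → ℚ) → Subset k → Set
Minimiser P f S = P S × ∀ S′ → P S′ → f S ℚ.≤ f S′

¬¬-minimiser : ∀ {k} (P : Subset k → Set) (f : Subset k → ℚ) →
  ¬ ¬ ((∀ S → ¬ P S) ⊎ ∃ (Minimiser P f))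
¬¬-minimiser {ℕ.zero} P f ¬min = ¬¬-excluded-middle λ where
  (yes P[]) → ¬min (inj₂ ([] , P[] , λ { [] _ → ℚ.≤-refl }))
  (no ¬P[]) → ¬min (inj₁ λ { [] → ¬P[] })
¬¬-minimiser {ℕ.suc k} P f ¬min =
  ¬¬-minimiser (P ∘ (inside ∷_)) (f ∘ (inside ∷_)) λ withInside →
  ¬¬-minimiser (P ∘ (outside ∷_)) (f ∘ (outside ∷_)) λ withOutside →
  ¬min (combine withInside withOutside)
  where
  combine : (∀ S → ¬ P (inside ∷ S)) ⊎ ∃ (Minimiser (P ∘ (inside ∷_)) (f ∘ (inside ∷_))) →
            (∀ S → ¬ P (outside ∷ S)) ⊎ ∃ (Minimiser (P ∘ (outside ∷_)) (f ∘ (outside ∷_))) →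
            (∀ S → ¬ P S) ⊎ ∃ (Minimiser P f)
  combine (inj₁ ¬P₁) (inj₁ ¬P₀) = inj₁ λ { (inside ∷ S) → ¬P₁ S ; (outside ∷ S) → ¬P₀ S }
  combine (inj₁ ¬P₁) (inj₂ (S , PS , min)) =
    inj₂ (outside ∷ S , PS , λ where
      (inside ∷ S′) PS′ → ⊥-elim (¬P₁ S′ PS′)
      (outside ∷ S′) → min S′)
  combine (inj₂ (S , PS , min)) (inj₁ ¬P₀) =
    inj₂ (inside ∷ S , PS , λ where
      (inside ∷ S′) → min S′
      (outside ∷ S′) PS′ → ⊥-elim (¬P₀ S′ PS′))
  combine (inj₂ (S , PS , min)) (inj₂ (S′ , PS′ , min′))
    with ℚ.≤-total (f (inside ∷ S)) (f (outside ∷ S′))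
  ... | inj₁ S≤S′ = inj₂ (inside ∷ S , PS , λ where
    (inside ∷ R) → min R
    (outside ∷ R) PR → ℚ.≤-trans S≤S′ (min′ R PR))
  ... | inj₂ S′≤S = inj₂ (outside ∷ S′ , PS′ , λ where
    (inside ∷ R) PR → ℚ.≤-trans S′≤S (min R PR)
    (outside ∷ R) → min′ R)

module _ (G : Graph) where
  open Graph G using (order)

  Adj-sym : ∀ {u v} → Adj G u v → Adj G v u
  Adj-sym {u} {v} uv = trans (sym (Graph.sym G u v)) uv

  Walk-start : ∀ {C u v} → Walk G C u v → u ∈ C
  Walk-start (here u∈C) = u∈C
  Walk-start (step u∈C _ _) = u∈C

  Walk-end : ∀ {C u v} → Walk G C u v → v ∈ C
  Walk-end (here u∈C) = u∈C
  Walk-end (step _ _ walk) = Walk-end walk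

  Walk-++ : ∀ {C u v x} → Walk G C u v → Walk G C v x → Walk G C u x
  Walk-++ (here _) walk′ = walk′
  Walk-++ (step u∈C uv walk) walk′ = step u∈C uv (Walk-++ walk walk′)

  Walk-reverse : ∀ {C u v} → Walk G C u v → Walk G C v u
  Walk-reverse (here u∈C) = here u∈C
  Walk-reverse (step u∈C uv walk) =
    Walk-++ (Walk-reverse walk) (step (Walk-start walk) (Adj-sym uv) (here u∈C))

  Walk-⊆ : ∀ {C C′} → C ⊆ C′ → ∀ {u v} → Walk G C u v → Walk G C′ u v
  Walk-⊆ C⊆C′ (here u∈C) = here (C⊆C′ u∈C)
  Walk-⊆ C⊆C′ (step u∈C uv walk) = step (C⊆C′ u∈C) uv (Walk-⊆ C⊆C′ walk)

  Walk-stays-in-component : ∀ {A C X} → IsComponent G A C → X ⊆ A →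
    ∀ {u v} → Walk G X u v → u ∈ C → v ∈ C
  Walk-stays-in-component _ _ (here _) u∈C = u∈C
  Walk-stays-in-component {C = C} C-comp X⊆A (step {u} {v} _ uv walk) u∈C with v ∈? C
  ... | yes v∈C = Walk-stays-in-component C-comp X⊆A walk v∈C
  ... | no v∉C = ⊥-elim (proj₂ (proj₂ (proj₂ C-comp)) u v u∈C (X⊆A (Walk-start walk)) v∉C uv)

  connected-isComponent : ∀ {S} → Nonempty S → Connected G S → IsComponent G S S
  connected-isComponent S≠∅ S-connected = id , S≠∅ , S-connected , λ _ _ _ v∈S v∉S _ → v∉S v∈S

  reachable-set-isComponent : ∀ {A D y} → y ∈ A → (∀ u → u ∈ D ⇔ Walk G A y u) → IsComponent G A D
  reachable-set-isComponent {A} {D} {y} y∈A D⇔ =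
    Walk-end ∘ reach , (y , reached (here y∈A)) , D-connected , D-maximal
    where
    reach : ∀ {u} → u ∈ D → Walk G A y u
    reach = Equivalence.to (D⇔ _)
    reached : ∀ {u} → Walk G A y u → u ∈ D
    reached = Equivalence.from (D⇔ _)
    extend : ∀ {u v} → Walk G A y u → Adj G u v → v ∈ A → Walk G A y v
    extend yu uv v∈A = Walk-++ yu (step (Walk-end yu) uv (here v∈A))
    within-D : ∀ {u v} → Walk G A u v → Walk G A y u → Walk G D u v
    within-D (here _) yu = here (reached yu)
    within-D (step _ uv walk) yu = step (reached yu) uv (within-D walk (extend yu uv (Walk-start walk)))
    D-connected : Connected G D
    D-connected u v u∈D v∈D = within-D (Walk-++ (Walk-reverse (reach u∈D)) (reach v∈D)) (reach u∈D)
    D-maximal : ∀ u v → u ∈ D → v ∈ A → v ∉ D → ¬ Adj G u v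
    D-maximal u v u∈D v∈A v∉D uv = v∉D (reached (extend (reach u∈D) uv v∈A))

  ¬¬-component : ∀ {A y} → y ∈ A →
    ¬ ¬ (∃ λ D → IsComponent G A D × ∀ {u} → Walk G A y u → u ∈ D)
  ¬¬-component {A} {y} y∈A ¬D = ¬¬-comprehension (Walk G A y) λ (D , D⇔) →
    ¬D (D , reachable-set-isComponent y∈A D⇔ , Equivalence.from (D⇔ _))

  complement-component-joined : ConnectedGraph G → ∀ {S s D} → s ∈ S →
    IsComponent G (∁ S) D → Joined G S D
  complement-component-joined G-connected {S} {s} {D} s∈S (D⊆∁S , (d , d∈D) , _ , D-maximal) =
    first-exit (G-connected d s ∈⊤ ∈⊤) d∈D
    where
    first-exit : ∀ {u} → Walk G ⊤ u s → u ∈ D → Joined G S D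
    first-exit (here _) s∈D = ⊥-elim (x∈∁p⇒x∉p (D⊆∁S s∈D) s∈S)
    first-exit (step {u} {v} _ uv walk) u∈D with v ∈? S | v ∈? D
    ... | yes v∈S | _ = v , u , v∈S , u∈D , Adj-sym uv
    ... | no _ | yes v∈D = first-exit walk v∈D
    ... | no v∉S | no v∉D = ⊥-elim (D-maximal u v u∈D (x∉p⇒x∈∁p v∉S) v∉D uv)

  ⊤-isConnSafe : ConnectedGraph G → ∀ w → Nonempty {order} ⊤ → IsConnSafe G w ⊤
  ⊤-isConnSafe G-connected w ⊤≠∅ = (⊤≠∅ , no-outside) , G-connected
    where
    no-outside : ∀ C D → IsComponent G ⊤ C → IsComponent G (∁ ⊤) D → Joined G C D →
      wsum G w D ℚ.≤ wsum G w C
    no-outside _ _ _ (D⊆∅ , (d , d∈D) , _) _ = ⊥-elim (x∈∁p⇒x∉p (D⊆∅ d∈D) ∈⊤)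

-- The complete bipartite graph on Fin B is given by its side function σ, with σ true on the smaller side.
module BipartiteContraction
  (G : Graph) (G-connected : ConnectedGraph G)
  {B : ℕ} (φ : Fin (Graph.order G) → Fin B) (φ-surjective : ∀ h → ∃ λ v → φ v ≡ h)
  (σ : Fin B → Bool)
  (φ-contracts : ∀ {h h′} → h ≢ h′ → Joined G (fibre φ h) (fibre φ h′) ⇔ (σ h ≢ σ h′))
  (fibre-connected : ∀ h → Connected G (fibre φ h))
  (h₀ : Fin B) (fibre-trivial : ∀ {h} → h ≢ h₀ → ∀ {u v} → φ u ≡ h → φ v ≡ h → u ≡ v)
  (2≤p : 2 ≤ count σ) (p<q : count σ < count (not ∘ σ))
  where

  open Graph G using (order)

  p q : ℕ
  p = count σ
  q = count (not ∘ σ)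

  vertexOf : Fin B → Fin order
  vertexOf h = proj₁ (φ-surjective h)

  edge-crosses : ∀ {u v} → Adj G u v → φ u ≢ φ v → σ (φ u) ≢ σ (φ v)
  edge-crosses {u} {v} uv φu≢φv =
    Equivalence.to (φ-contracts φu≢φv) (u , v , ∈-fibre⁺ φ refl , ∈-fibre⁺ φ refl , uv)

  sides-joined : ∀ {h h′} → σ h ≢ σ h′ → Joined G (fibre φ h) (fibre φ h′)
  sides-joined σh≢σh′ = Equivalence.from (φ-contracts (σh≢σh′ ∘ cong σ)) σh≢σh′

  one-sided-walk : ∀ {X b} → (∀ {x} → x ∈ X → σ (φ x) ≡ b) →
    ∀ {u v} → Walk G X u v → φ u ≡ φ v
  one-sided-walk X-side (here _) = refl
  one-sided-walk X-side (step {u} {v} u∈X uv walk) with φ u ≟ φ v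
  ... | yes φu≡φv = trans φu≡φv (one-sided-walk X-side walk)
  ... | no φu≢φv = ⊥-elim (edge-crosses uv φu≢φv (trans (X-side u∈X) (sym (X-side (Walk-start G walk)))))

  one-sided-connected⊆fibre : ∀ {X b x₀} → (∀ {x} → x ∈ X → σ (φ x) ≡ b) →
    Connected G X → x₀ ∈ X → X ⊆ fibre φ (φ x₀)
  one-sided-connected⊆fibre X-side X-connected x₀∈X x∈X =
    ∈-fibre⁺ φ (sym (one-sided-walk X-side (X-connected _ _ x₀∈X x∈X)))

  c : ℕ
  c = count (λ v → does (φ v ≟ h₀))

  W : Fin order → ℕ
  W v = if does (φ v ≟ h₀) then 1 else c

  w : Fin order → ℚ
  w = toℚ ∘ W

  weight : Subset order → ℕ
  weight X = ∑[ v < order ] (W v when does (v ∈? X))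

  weightIn : Subset order → Fin B → ℕ
  weightIn X h = ∑[ v < order ] ((W v when does (v ∈? X)) when does (φ v ≟ h))

  1≤c : 1 ≤ c
  1≤c = subst (λ b → 1 when b ≤ c) (dec-true (φ v₀ ≟ h₀) (proj₂ (φ-surjective h₀))) (≤-∑ _ v₀)
    where v₀ = vertexOf h₀

  1≤W : ∀ v → 1 ≤ W v
  1≤W v with φ v ≟ h₀
  ... | yes _ = ℕ.≤-refl
  ... | no _ = 1≤c

  w-positive : PositiveWeight G w
  w-positive v = toℚ-mono-< (1≤W v)

  wsum-w : ∀ X → wsum G w X ≡ toℚ (weight X)
  wsum-w = wsum-toℚ G W

  weight-mono : ∀ {X Y} → X ⊆ Y → weight X ≤ weight Y
  weight-mono {X} {Y} X⊆Y = ∑-mono-≤ pointwise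
    where
    pointwise : ∀ v → W v when does (v ∈? X) ≤ W v when does (v ∈? Y)
    pointwise v with v ∈? X | v ∈? Y
    ... | no _ | _ = z≤n
    ... | yes _ | yes _ = ℕ.≤-refl
    ... | yes v∈X | no v∉Y = ⊥-elim (v∉Y (X⊆Y v∈X))

  weight≡∑weightIn : ∀ X → weight X ≡ ∑[ h < B ] weightIn X h
  weight≡∑weightIn X = trans (sum-cong-≗ (λ v → sym (∑-point (φ v) _)))
                             (∑-comm (λ v h → (W v when does (v ∈? X)) when does (φ v ≟ h)))

  ∑-over-trivial-fibre : ∀ {h} → h ≢ h₀ → (f : Fin order → ℕ) →
    ∑[ v < order ] (f v when does (φ v ≟ h)) ≡ f (vertexOf h)
  ∑-over-trivial-fibre {h} h≢h₀ f = trans (sum-cong-≗ pointwise) (∑-point (vertexOf h) _)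
    where
    pointwise : ∀ v → f v when does (φ v ≟ h) ≡ f (vertexOf h) when does (vertexOf h ≟ v)
    pointwise v with φ v ≟ h | vertexOf h ≟ v
    ... | yes φv≡h | yes refl = refl
    ... | yes φv≡h | no vₕ≢v = ⊥-elim (vₕ≢v (fibre-trivial h≢h₀ (proj₂ (φ-surjective h)) φv≡h))
    ... | no φv≢h | yes refl = ⊥-elim (φv≢h (proj₂ (φ-surjective h)))
    ... | no _ | no _ = refl

  fibre-weight : ∀ h → ∑[ v < order ] (W v when does (φ v ≟ h)) ≡ c
  fibre-weight h with h ≟ h₀
  ... | yes refl = sum-cong-≗ pointwise
    where
    pointwise : ∀ v → W v when does (φ v ≟ h₀) ≡ 1 when does (φ v ≟ h₀)
    pointwise v with φ v ≟ h₀
    ... | yes _ = refl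
    ... | no _ = refl
  ... | no h≢h₀ = trans (∑-over-trivial-fibre h≢h₀ W) W-vertex
    where
    W-vertex : W (vertexOf h) ≡ c
    W-vertex with φ (vertexOf h) ≟ h₀
    ... | yes φvₕ≡h₀ = ⊥-elim (h≢h₀ (trans (sym (proj₂ (φ-surjective h))) φvₕ≡h₀))
    ... | no _ = refl

  weight-fibre : ∀ h → weight (fibre φ h) ≡ c
  weight-fibre h = trans (sum-cong-≗ λ v → cong (W v when_) (does-∈?-fibre φ)) (fibre-weight h)

  W≤weightIn : ∀ {X v} → v ∈ X → W v ≤ weightIn X (φ v)
  W≤weightIn {X} {v} v∈X = subst (_≤ weightIn X (φ v)) term≡W (≤-∑ _ v)
    where
    term≡W : (W v when does (v ∈? X)) when does (φ v ≟ φ v) ≡ W v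
    term≡W rewrite dec-true (v ∈? X) v∈X | dec-true (φ v ≟ φ v) refl = refl

  weightIn-⊇fibre : ∀ {X h} → fibre φ h ⊆ X → weightIn X h ≡ c
  weightIn-⊇fibre {X} {h} fibre⊆X = trans (sum-cong-≗ pointwise) (fibre-weight h)
    where
    pointwise : ∀ v → (W v when does (v ∈? X)) when does (φ v ≟ h) ≡ W v when does (φ v ≟ h)
    pointwise v with φ v ≟ h
    ... | no _ = refl
    ... | yes φv≡h rewrite dec-true (v ∈? X) (fibre⊆X (∈-fibre⁺ φ φv≡h)) = refl

  weightIn-disjoint : ∀ {X h} → (∀ {v} → φ v ≡ h → v ∉ X) → weightIn X h ≡ 0
  weightIn-disjoint {X} {h} disjoint = trans (sum-cong-≗ pointwise) (sum-replicate-zero order)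
    where
    pointwise : ∀ v → (W v when does (v ∈? X)) when does (φ v ≟ h) ≡ 0
    pointwise v with φ v ≟ h
    ... | no _ = refl
    ... | yes φv≡h rewrite dec-false (v ∈? X) (disjoint φv≡h) = refl

  weightIn≤c : ∀ X h → weightIn X h ≤ c
  weightIn≤c X h = ℕ.≤-trans (∑-mono-≤ pointwise) (ℕ.≤-reflexive (fibre-weight h))
    where
    pointwise : ∀ v → (W v when does (v ∈? X)) when does (φ v ≟ h) ≤ W v when does (φ v ≟ h)
    pointwise v with φ v ≟ h | v ∈? X
    ... | no _ | _ = z≤n
    ... | yes _ | yes _ = ℕ.≤-refl
    ... | yes _ | no _ = z≤n

  small : Subset order
  small = tabulate (σ ∘ φ)

  weight-small : weight small ≡ p * c
  weight-small = begin
    weight small                  ≡⟨ weight≡∑weightIn small ⟩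
    ∑[ h < B ] weightIn small h   ≡⟨ sum-cong-≗ weightIn-small ⟩
    ∑[ h < B ] (c when σ h)       ≡⟨ ∑-when σ c ⟩
    p * c                         ∎
    where
    open ≡-Reasoning
    weightIn-small : ∀ h → weightIn small h ≡ c when σ h
    weightIn-small h with σ h in σh
    ... | true = weightIn-⊇fibre λ v∈ →
                   Equivalence.from ∈-tabulate⇔ (trans (cong σ (∈-fibre⁻ φ v∈)) σh)
    ... | false = weightIn-disjoint λ {v} φv≡h v∈small →
                   not-¬ σh (trans (cong σ (sym φv≡h)) (Equivalence.to ∈-tabulate⇔ v∈small))

  small-safe : IsSafe G w small
  small-safe = (vertexOf h₁ , Equivalence.from ∈-tabulate⇔ σφv₁) , components-balanced
    where
    h₁ = proj₁ (count-positive σ (ℕ.<-≤-trans (s≤s z≤n) 2≤p))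
    σφv₁ : σ (φ (vertexOf h₁)) ≡ true
    σφv₁ = trans (cong σ (proj₂ (φ-surjective h₁))) (Equivalence.to T-≡ (proj₂ (count-positive σ _)))
    components-balanced : ∀ C D → IsComponent G small C → IsComponent G (∁ small) D → Joined G C D →
      wsum G w D ℚ.≤ wsum G w C
    components-balanced C D C-comp@(C⊆small , (c₀ , c₀∈C) , _)
                            (D⊆large , (d₀ , d₀∈D) , D-connected , _) _ =
      subst₂ ℚ._≤_ (sym (wsum-w D)) (sym (wsum-w C)) (toℚ-mono-≤ (begin
        weight D                    ≤⟨ weight-mono (one-sided-connected⊆fibre D-large D-connected d₀∈D) ⟩
        weight (fibre φ (φ d₀))     ≡⟨ weight-fibre (φ d₀) ⟩
        c                           ≡⟨ weight-fibre (φ c₀) ⟨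
        weight (fibre φ (φ c₀))     ≤⟨ weight-mono fibre⊆C ⟩
        weight C                    ∎))
      where
      open ℕ.≤-Reasoning
      D-large : ∀ {x} → x ∈ D → σ (φ x) ≡ false
      D-large x∈D = ¬-not (x∈∁p⇒x∉p (D⊆large x∈D) ∘ Equivalence.from ∈-tabulate⇔)
      fibre⊆small : fibre φ (φ c₀) ⊆ small
      fibre⊆small x∈ = Equivalence.from ∈-tabulate⇔
        (trans (cong σ (∈-fibre⁻ φ x∈)) (Equivalence.to ∈-tabulate⇔ (C⊆small c₀∈C)))
      fibre⊆C : fibre φ (φ c₀) ⊆ C
      fibre⊆C x∈ = Walk-stays-in-component G C-comp fibre⊆small
        (fibre-connected (φ c₀) c₀ _ (∈-fibre⁺ φ refl) x∈) c₀∈C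

  module LightConnectedSafeSet {S} (S-connSafe : IsConnSafe G w S) (S-light : weight S ≤ p * c) where

    touched : Fin B → Bool
    touched h = 0 ℕ.<ᵇ weightIn S h

    k z : ℕ
    k = count touched
    z = count (not ∘ touched)

    touched-∈ : ∀ {v} → v ∈ S → T (touched (φ v))
    touched-∈ {v} v∈S = ℕ.<⇒<ᵇ (ℕ.≤-trans (1≤W v) (W≤weightIn v∈S))

    touched⇒∈ : ∀ {h} → T (touched h) → ∃ λ v → φ v ≡ h × v ∈ S
    touched⇒∈ {h} touched-h with ∑-positive _ (ℕ.<ᵇ⇒< 0 _ touched-h)
    ... | v , 0<term with φ v ≟ h | v ∈? S | 0<term
    ...   | yes φv≡h | yes v∈S | _ = v , φv≡h , v∈S
    ...   | yes _ | no _ | ()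
    ...   | no _ | _ | ()

    untouched-∉ : ∀ {h v} → ¬ T (touched h) → φ v ≡ h → v ∈ ∁ S
    untouched-∉ untouched refl = x∉p⇒x∈∁p (untouched ∘ touched-∈)

    weightIn-trivial-touched : ∀ {h} → h ≢ h₀ → T (touched h) → weightIn S h ≡ c
    weightIn-trivial-touched h≢h₀ touched-h with touched⇒∈ touched-h
    ... | v , φv≡h , v∈S = weightIn-⊇fibre λ x∈ →
      subst (_∈ S) (fibre-trivial h≢h₀ φv≡h (∈-fibre⁻ φ x∈)) v∈S

    -- Only the fibre of h₀ can be met partially, and it then contributes at least 1 instead of c.
    k*c≤weight : k * c ≤ weight S + (c ∸ 1)
    k*c≤weight = begin
      k * c
        ≡⟨ ∑-when touched c ⟨
      ∑[ h < B ] (c when touched h)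
        ≤⟨ ∑-mono-≤ pointwise ⟩
      ∑[ h < B ] (weightIn S h + (c ∸ 1) when does (h₀ ≟ h))
        ≡⟨ ∑-distrib-+ (weightIn S) _ ⟩
      ∑[ h < B ] weightIn S h + ∑[ h < B ] ((c ∸ 1) when does (h₀ ≟ h))
        ≡⟨ cong₂ _+_ (sym (weight≡∑weightIn S)) (∑-point h₀ (c ∸ 1)) ⟩
      weight S + (c ∸ 1)
        ∎
      where
      open ℕ.≤-Reasoning
      pointwise : ∀ h → c when touched h ≤ weightIn S h + (c ∸ 1) when does (h₀ ≟ h)
      pointwise h with touched h in touched-h | h₀ ≟ h
      ... | false | _ = z≤n
      ... | true | yes refl = begin
        c                         ≡⟨ ℕ.m+[n∸m]≡n 1≤c ⟨
        1 + (c ∸ 1)               ≤⟨ ℕ.+-monoˡ-≤ (c ∸ 1) (ℕ.<ᵇ⇒< 0 _ (Equivalence.from T-≡ touched-h)) ⟩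
        weightIn S h₀ + (c ∸ 1)   ∎
      ... | true | no h₀≢h = begin
        c                ≡⟨ weightIn-trivial-touched (h₀≢h ∘ sym) (Equivalence.from T-≡ touched-h) ⟨
        weightIn S h     ≤⟨ ℕ.m≤m+n _ 0 ⟩
        weightIn S h + 0 ∎

    k≤p : k ≤ p
    k≤p = ℕ.≤-pred (ℕ.*-cancelʳ-< c k (ℕ.suc p) (begin-strict
      k * c                ≤⟨ k*c≤weight ⟩
      weight S + (c ∸ 1)   ≤⟨ ℕ.+-monoˡ-≤ (c ∸ 1) S-light ⟩
      p * c + (c ∸ 1)      <⟨ ℕ.+-monoʳ-< (p * c) (ℕ.∸-monoʳ-< ℕ.0<1+n 1≤c) ⟩
      p * c + c            ≡⟨ ℕ.+-comm (p * c) c ⟩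
      ℕ.suc p * c          ∎))
      where open ℕ.≤-Reasoning

    weight≤k*c : weight S ≤ k * c
    weight≤k*c = begin
      weight S                        ≡⟨ weight≡∑weightIn S ⟩
      ∑[ h < B ] weightIn S h         ≤⟨ ∑-mono-≤ pointwise ⟩
      ∑[ h < B ] (c when touched h)   ≡⟨ ∑-when touched c ⟩
      k * c                           ∎
      where
      open ℕ.≤-Reasoning
      pointwise : ∀ h → weightIn S h ≤ c when touched h
      pointwise h with weightIn S h | weightIn≤c S h
      ... | ℕ.zero | _ = z≤n
      ... | ℕ.suc _ | weight≤c = weight≤c

    k+z≡p+q : k + z ≡ p + q
    k+z≡p+q = trans (count-complement touched) (sym (count-complement σ))

    S≠∅ : Nonempty S
    S≠∅ = proj₁ (proj₁ S-connSafe)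

    S-connected : Connected G S
    S-connected = proj₂ S-connSafe

    not-all-large-touched : ¬ (∀ h → T (not (σ h)) → T (touched h))
    not-all-large-touched all-large =
      ℕ.<-irrefl refl (ℕ.<-≤-trans p<q (ℕ.≤-trans (count-mono all-large) k≤p))

    not-all-small-touched : ¬ (∀ h → T (σ h) → T (touched h))
    not-all-small-touched all-small with any? (λ v → (v ∈? S) ×-dec (σ (φ v) ≟ᵇ false))
    ... | yes (v , v∈S , σφv≡false) =
      ℕ.<-irrefl refl (ℕ.<-≤-trans (count-insert (φ v) all-small (subst T σφv≡false) (touched-∈ v∈S)) k≤p)
    ... | no ¬large = ℕ.<-irrefl refl (ℕ.<-≤-trans 2≤p (ℕ.≤-trans (count-mono all-small) k≤1))
      where
      s₀ = proj₁ S≠∅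
      S-small : ∀ {x} → x ∈ S → σ (φ x) ≡ true
      S-small x∈S = ¬-not λ σφx≡false → ¬large (_ , x∈S , σφx≡false)
      k≤1 : k ≤ 1
      k≤1 = count-≤1 (φ s₀) λ h touched-h → case touched⇒∈ touched-h of λ where
        (v , refl , v∈S) →
          ∈-fibre⁻ φ (one-sided-connected⊆fibre S-small S-connected (proj₂ S≠∅) v∈S)

    untouched-walk : ∀ {u v} → φ u ≡ φ v → ¬ T (touched (φ u)) → Walk G (∁ S) u v
    untouched-walk {u} {v} φu≡φv untouched =
      Walk-⊆ G (λ x∈ → untouched-∉ untouched (∈-fibre⁻ φ x∈))
        (fibre-connected (φ u) u v (∈-fibre⁺ φ refl) (∈-fibre⁺ φ (sym φu≡φv)))

    untouched-link : ∀ {u v} → σ (φ u) ≢ σ (φ v) → ¬ T (touched (φ u)) → ¬ T (touched (φ v)) →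
      Walk G (∁ S) u v
    untouched-link σφu≢σφv untouched-u untouched-v with sides-joined σφu≢σφv
    ... | x , y , x∈ , y∈ , xy =
      Walk-++ G (untouched-walk (sym (∈-fibre⁻ φ x∈)) untouched-u)
        (step (untouched-∉ untouched-u (∈-fibre⁻ φ x∈)) xy
          (untouched-walk (∈-fibre⁻ φ y∈) (untouched-v ∘ subst (T ∘ touched) (∈-fibre⁻ φ y∈))))

    -- Inside G - S, every untouched fibre is joined to X or to Y (whichever lies on the other side),
    -- and X to Y; so all untouched fibres lie in one component, which then outweighs S.
    no-untouched-pair : ∀ {X Y} → T (σ X) → ¬ T (touched X) → T (not (σ Y)) → ¬ T (touched Y) → ⊥
    no-untouched-pair {X} {Y} σX untouched-X σY untouched-Y =
      ¬¬-component G (untouched-∉ untouched-Y (proj₂ (φ-surjective Y))) λ (D , D-comp , D-reached) →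
      ℕ.<-irrefl refl (ℕ.<-≤-trans p<q (q≤p (ℕ.*-cancelʳ-≤ z k c {{nonZero}} (begin
        z * c      ≤⟨ untouched-weight D-reached ⟩
        weight D   ≤⟨ D≤S D-comp ⟩
        weight S   ≤⟨ weight≤k*c ⟩
        k * c      ∎))))
      where
      open ℕ.≤-Reasoning
      nonZero : ℕ.NonZero c
      nonZero = ℕ.>-nonZero 1≤c
      x₀ = vertexOf X
      y₀ = vertexOf Y
      untouched-x₀ : ¬ T (touched (φ x₀))
      untouched-x₀ = untouched-X ∘ subst (T ∘ touched) (proj₂ (φ-surjective X))
      untouched-y₀ : ¬ T (touched (φ y₀))
      untouched-y₀ = untouched-Y ∘ subst (T ∘ touched) (proj₂ (φ-surjective Y))
      σx₀≢σy₀ : σ (φ x₀) ≢ σ (φ y₀)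
      σx₀≢σy₀ rewrite proj₂ (φ-surjective X) | proj₂ (φ-surjective Y) | Equivalence.to T-≡ σX
                    | Equivalence.to T-not-≡ σY = λ ()
      reach-y₀ : ∀ {v} → ¬ T (touched (φ v)) → Walk G (∁ S) v y₀
      reach-y₀ {v} untouched with σ (φ v) ≟ᵇ σ (φ y₀)
      ... | no σφv≢σy₀ = untouched-link σφv≢σy₀ untouched untouched-y₀
      ... | yes σφv≡σy₀ = Walk-++ G
        (untouched-link (λ e → σx₀≢σy₀ (trans (sym e) σφv≡σy₀)) untouched untouched-x₀)
        (untouched-link σx₀≢σy₀ untouched-x₀ untouched-y₀)
      untouched-weight : ∀ {D} → (∀ {u} → Walk G (∁ S) y₀ u → u ∈ D) → z * c ≤ weight D
      untouched-weight {D} D-reached = begin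
        z * c                               ≡⟨ ∑-when (not ∘ touched) c ⟨
        ∑[ h < B ] (c when not (touched h)) ≤⟨ ∑-mono-≤ pointwise ⟩
        ∑[ h < B ] weightIn D h             ≡⟨ weight≡∑weightIn D ⟨
        weight D                            ∎
        where
        pointwise : ∀ h → c when not (touched h) ≤ weightIn D h
        pointwise h with touched h in touched-h
        ... | true = z≤n
        ... | false = ℕ.≤-reflexive (sym (weightIn-⊇fibre λ x∈ → D-reached (Walk-reverse G
                (reach-y₀ (subst T touched-h ∘ subst (T ∘ touched) (∈-fibre⁻ φ x∈))))))
      D≤S : ∀ {D} → IsComponent G (∁ S) D → weight D ≤ weight S
      D≤S D-comp = toℚ-cancel-≤ (subst₂ ℚ._≤_ (wsum-w _) (wsum-w S)
        (proj₂ (proj₁ S-connSafe) S _ (connected-isComponent G S≠∅ S-connected) D-comp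
          (complement-component-joined G G-connected (proj₂ S≠∅) D-comp)))
      q≤p : z ≤ k → q ≤ p
      q≤p z≤k = ℕ.+-cancelˡ-≤ p q p (begin
        p + q   ≡⟨ k+z≡p+q ⟨
        k + z   ≤⟨ ℕ.+-mono-≤ k≤p (ℕ.≤-trans z≤k k≤p) ⟩
        p + p   ∎)

    impossible : ⊥
    impossible with any? (λ h → T? (σ h) ×-dec ¬? (T? (touched h)))
    ... | no ¬X = not-all-small-touched λ h σh → decidable-stable (T? _) λ ¬t → ¬X (h , σh , ¬t)
    ... | yes (X , σX , untouched-X) with any? (λ h → T? (not (σ h)) ×-dec ¬? (T? (touched h)))
    ...   | no ¬Y = not-all-large-touched λ h σh → decidable-stable (T? _) λ ¬t → ¬Y (h , σh , ¬t)
    ...   | yes (Y , σY , untouched-Y) = no-untouched-pair σX untouched-X σY untouched-Y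

  light-as-safe-minimum : ∀ {S S₁} → Minimiser (IsSafe G w) (wsum G w) S₁ → wsum G w S ≡ wsum G w S₁ →
    weight S ≤ p * c
  light-as-safe-minimum {S} {S₁} (_ , S₁-min) S≡S₁ = toℚ-cancel-≤ (begin
    toℚ (weight S)   ≡⟨ wsum-w S ⟨
    wsum G w S       ≡⟨ S≡S₁ ⟩
    wsum G w S₁      ≤⟨ S₁-min small small-safe ⟩
    wsum G w small   ≡⟨ trans (wsum-w small) (cong toℚ weight-small) ⟩
    toℚ (p * c)      ∎)
    where open ℚ.≤-Reasoning

  ¬InGcs : ¬ InGcs G
  ¬InGcs G∈Gcs = ¬¬-minimiser (IsSafe G w) (wsum G w) λ where
    (inj₁ no-safe-set) → no-safe-set small small-safe
    (inj₂ (S₁ , S₁-minimiser)) → ¬¬-minimiser (IsConnSafe G w) (wsum G w) λ where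
      (inj₁ no-connSafe-set) → no-connSafe-set ⊤ (⊤-isConnSafe G G-connected w (vertexOf h₀ , ∈⊤))
      (inj₂ (S₂ , S₂-connSafe , S₂-min)) →
        LightConnectedSafeSet.impossible S₂-connSafe (light-as-safe-minimum S₁-minimiser (sym
          (G∈Gcs w w-positive _ _ ((S₁ , proj₁ S₁-minimiser , refl) , proj₂ S₁-minimiser)
                                  ((S₂ , S₂-connSafe , refl) , S₂-min))))

-- The side function of Kbip, which Kbip keeps local; defined the same way so that Kbip-Adj⇔
-- holds by computation.
isLeft : ∀ m {n} → Fin (m + n) → Bool
isLeft m v with splitAt m v
... | inj₁ _ = true
... | inj₂ _ = false

Kbip-Adj⇔ : ∀ {m n} {h h′ : Fin (m + n)} → Adj (Kbip m n) h h′ ⇔ (isLeft m h ≢ isLeft m h′)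
Kbip-Adj⇔ {m} {n} {h} {h′} with splitAt m h | splitAt m h′
... | inj₁ _ | inj₁ _ = mk⇔ (λ ()) (λ ne → ⊥-elim (ne refl))
... | inj₁ _ | inj₂ _ = mk⇔ (λ _ ()) (λ _ → refl)
... | inj₂ _ | inj₁ _ = mk⇔ (λ _ ()) (λ _ → refl)
... | inj₂ _ | inj₂ _ = mk⇔ (λ ()) (λ ne → ⊥-elim (ne refl))

count-isLeft : ∀ m n → count (isLeft m {n}) ≡ m
count-isLeft ℕ.zero n = sum-replicate-zero n
count-isLeft (ℕ.suc m) n = cong ℕ.suc (trans (sum-cong-≗ (cong (1 when_) ∘ isLeft-suc)) (count-isLeft m n))
  where
  isLeft-suc : ∀ i → isLeft (ℕ.suc m) (suc i) ≡ isLeft m {n} i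
  isLeft-suc i with splitAt m i
  ... | inj₁ _ = refl
  ... | inj₂ _ = refl

count-isRight : ∀ m n → count (not ∘ isLeft m {n}) ≡ n
count-isRight m n = ℕ.+-cancelˡ-≡ m _ _
  (trans (cong (_+ count (not ∘ isLeft m)) (sym (count-isLeft m n))) (count-complement (isLeft m)))

Kbip-smaller-side : ∀ {m n} → 2 ≤ m → 2 ≤ n → m ≢ n → ∃ λ (σ : Fin (m + n) → Bool) →
  (∀ {h h′} → Adj (Kbip m n) h h′ ⇔ (σ h ≢ σ h′)) × 2 ≤ count σ × count σ < count (not ∘ σ)
Kbip-smaller-side {m} {n} 2≤m 2≤n m≢n with ℕ.<-cmp m n
... | tri< m<n _ _ = isLeft m , Kbip-Adj⇔ , subst (2 ≤_) (sym (count-isLeft m n)) 2≤m ,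
                     subst₂ _<_ (sym (count-isLeft m n)) (sym (count-isRight m n)) m<n
... | tri≈ _ m≡n _ = ⊥-elim (m≢n m≡n)
... | tri> _ _ n<m = not ∘ isLeft m , ≢⇔not-≢ ⇔-∘ Kbip-Adj⇔ ,
                     subst (2 ≤_) (sym (count-isRight m n)) 2≤n ,
                     subst₂ _<_ (sym (count-isRight m n)) (sym count-not-isRight) n<m
  where
  ≢⇔not-≢ : ∀ {a b} → (a ≢ b) ⇔ (not a ≢ not b)
  ≢⇔not-≢ = mk⇔ (λ a≢b → a≢b ∘ not-injective) (λ na≢nb → na≢nb ∘ cong not)
  count-not-isRight : count (not ∘ (not ∘ isLeft m {n})) ≡ m
  count-not-isRight = trans (sum-cong-≗ (cong (1 when_) ∘ not-involutive ∘ isLeft m)) (count-isLeft m n)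

module _ (G H : Graph) (φ : Fin (Graph.order G) → Fin (Graph.order H)) where

  fibre-trivial-unless-big : ∀ {h} → ¬ BigBag G H φ h → ∀ {u v} → φ u ≡ h → φ v ≡ h → u ≡ v
  fibre-trivial-unless-big ¬big {u} {v} φu≡h φv≡h with u ≟ v
  ... | yes u≡v = u≡v
  ... | no u≢v = ⊥-elim (¬big (u , v , u≢v , φu≡h , φv≡h))

  fibres-connected : (∀ h → BigBag G H φ h → Connected G (bag G H φ h)) → ∀ h → Connected G (fibre φ h)
  fibres-connected big-connected h u v u∈ v∈ with u ≟ v
  ... | yes refl = here u∈
  ... | no u≢v = big-connected h (u , v , u≢v , ∈-fibre⁻ φ u∈ , ∈-fibre⁻ φ v∈) u v u∈ v∈

  ¬¬-at-most-one-big-fibre : Fin (Graph.order H) →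
    (∀ h h′ → BigBag G H φ h → BigBag G H φ h′ → h ≡ h′) →
    ¬ ¬ (∃ λ h₀ → ∀ {h} → h ≢ h₀ → ∀ {u v} → φ u ≡ h → φ v ≡ h → u ≡ v)
  ¬¬-at-most-one-big-fibre h-default big-unique ¬h₀ = ¬¬-excluded-middle {A = ∃ (BigBag G H φ)} λ where
    (yes (h₀ , big₀)) →
      ¬h₀ (h₀ , λ h≢h₀ → fibre-trivial-unless-big (λ big → h≢h₀ (big-unique _ _ big big₀)))
    (no ¬big) → ¬h₀ (h-default , λ {h} _ → fibre-trivial-unless-big (λ big → ¬big (h , big)))

lemma3p4 : (m n : ℕ) → 2 ≤ m → 2 ≤ n → m ≢ n →
    (G : Graph) → ConnectedGraph G →
    (φ : Fin (Graph.order G) → Fin (Graph.order (Kbip m n))) →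
    IsContraction G (Kbip m n) φ →
    (∀ h h' → BigBag G (Kbip m n) φ h → BigBag G (Kbip m n) φ h' → h ≡ h') →
    (∀ h → BigBag G (Kbip m n) φ h → Connected G (bag G (Kbip m n) φ h)) →
    ¬ InGcs G
lemma3p4 m@(ℕ.suc _) n 2≤m 2≤n m≢n G G-connected φ (φ-surjective , φ-contracts) big-unique big-connected
  with Kbip-smaller-side 2≤m 2≤n m≢n
... | σ , Adj⇔σ , 2≤p , p<q = λ G∈Gcs →
  ¬¬-at-most-one-big-fibre G (Kbip m n) φ zero big-unique λ (h₀ , fibre-trivial) →
  BipartiteContraction.¬InGcs G G-connected φ φ-surjective σ
    (λ h≢h′ → Adj⇔σ ⇔-∘ φ-contracts _ _ h≢h′) (fibres-connected G (Kbip m n) φ big-connected)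
    h₀ fibre-trivial 2≤p p<q G∈Gcs
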